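{- Let $H$ be the graph on eight vertices consisting of three $4$-cycles sharing a single edge, i.e. $H$ has vertices $u,v,x_1,y_1,x_2,y_2,x_3,y_3$ and edges $uv$ and $ux_i,\ x_iy_i,\ y_iv$ for $i=1,2,3$. Then for every $n\geq 1$, the Fibonacci-sum graph $G_n$ contains no subgraph isomorphic to $H$.
   Context: The Fibonacci numbers are defined by $F_0=0$, $F_1=1$ and $F_m=F_{m-1}+F_{m-2}$ for $m\geq 2$. For each integer $n\geq 1$, the Fibonacci-sum graph $G_n$ is the simple graph with vertex set $\{1,2,\dots,n\}$ in which distinct vertices $i,j$ are adjacent if and only if $i+j$ is a Fibonacci number. -}

module Defs where

open import Data.Nat using (ℕ; zero; suc; _+_; _≤_)
open import Data.Fin using (Fin; zero; suc)
open import Data.Product using (_×_; ∃-syntax)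
open import Relation.Binary.PropositionalEquality using (_≡_; _≢_)
open import Function.Definitions using (Injective)

fib : ℕ → ℕ
fib zero = zero
fib (suc zero) = suc zero
fib (suc (suc m)) = fib (suc m) + fib m

IsFib : ℕ → Set
IsFib k = ∃[ m ] fib m ≡ k

InRange : ℕ → ℕ → Set
InRange n i = (1 ≤ i) × (i ≤ n)

Adj : ℕ → ℕ → ℕ → Set
Adj n i j = InRange n i × InRange n j × (i ≢ j) × IsFib (i + j)

u v x₁ y₁ x₂ y₂ x₃ y₃ : Fin 8
u  = zero
v  = suc zero
x₁ = suc (suc zero)
y₁ = suc (suc (suc zero))
x₂ = suc (suc (suc (suc zero)))
y₂ = suc (suc (suc (suc (suc zero))))
x₃ = suc (suc (suc (suc (suc (suc zero)))))
y₃ = suc (suc (suc (suc (suc (suc (suc zero))))))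

data HEdge : Fin 8 → Fin 8 → Set where
  e-uv   : HEdge u v
  e-ux₁  : HEdge u x₁
  e-x₁y₁ : HEdge x₁ y₁
  e-y₁v  : HEdge y₁ v
  e-ux₂  : HEdge u x₂
  e-x₂y₂ : HEdge x₂ y₂
  e-y₂v  : HEdge y₂ v
  e-ux₃  : HEdge u x₃
  e-x₃y₃ : HEdge x₃ y₃
  e-y₃v  : HEdge y₃ v

ContainsH : ℕ → Set
ContainsH n =
  ∃[ f ] (Injective _≡_ _≡_ f
          × (∀ a → InRange n (f a))
          × (∀ {a b} → HEdge a b → Adj n (f a) (f b)))

-- Write U, V, X, Y for the labels of a 4-cycle u–x–y–v–u in G n.  The
-- identity (U + V) + (X + Y) = (U + X) + (Y + V) relates its four
-- Fibonacci edge sums.  Looking at an edge whose sum F t dominates the sums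
-- of its two neighbouring edges, a rigidity property of Fibonacci numbers
-- (F t + Q = F b + F d with b, d < t and Q ≥ 2 forces t = k + 3,
-- F b = F d = F (k + 2) and Q = F k) pins down the whole cycle.  Seen from
-- the shared edge uv only two situations remain:
--   * the cycle is Flat: U + V = F k and U + X = F (k + 2), or
--   * the cycle is Steep: one of three configurations in which U + X is
--     fixed by U + V and U, V satisfy upper bounds by Fibonacci numbers.
-- Given U and V, at most one X is flat (Fibonacci injectivity) and at most
-- one X is steep (two different steep configurations would force U + V
-- below its own value).  Hence by pigeonhole two of x₁, x₂, x₃ receive the
-- same label, contradicting the injectivity of an embedding of H.
module Submission where

open import Defs
open import Data.Nat using (ℕ; _≥_; zero; suc; _+_; _≤_; _<_; z≤n; s≤s; z<s; _≟_)
open import Data.Nat.Properties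
open import Data.Product using (_×_; _,_; ∃-syntax; proj₁; proj₂)
open import Data.Sum using (_⊎_; inj₁; inj₂; [_,_])
open import Data.Empty using (⊥; ⊥-elim)
open import Function using (_$_; _∘_)
open import Relation.Nullary using (¬_; yes; no)
open import Relation.Binary.PropositionalEquality
  using (_≡_; _≢_; refl; sym; trans; cong; cong₂; subst; module ≡-Reasoning)
open import Relation.Binary using (tri<; tri≈; tri>)
open import Data.Nat.Tactic.RingSolver using (solve-∀)

fib-≤-suc : ∀ n → fib n ≤ fib (suc n)
fib-≤-suc zero = z≤n
fib-≤-suc (suc zero) = ≤-refl
fib-≤-suc (suc (suc n)) = m≤m+n (fib (suc (suc n))) (fib (suc n))

fib-mono : ∀ {m n} → m ≤ n → fib m ≤ fib n
fib-mono {n = zero} z≤n = ≤-refl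
fib-mono {m} {suc n} m≤1+n with m≤n⇒m<n∨m≡n m≤1+n
... | inj₁ m<1+n = ≤-trans (fib-mono (≤-pred m<1+n)) (fib-≤-suc n)
... | inj₂ refl = ≤-refl

fib-pos : ∀ n → 1 ≤ fib (suc n)
fib-pos n = fib-mono {1} {suc n} (s≤s z≤n)

fib-strict : ∀ {m n} → m < n → fib (2 + m) < fib (2 + n)
fib-strict {m} {suc n} m<1+n with m≤n⇒m<n∨m≡n (≤-pred m<1+n)
... | inj₁ m<n = <-≤-trans (fib-strict m<n) (m≤m+n (fib (2 + n)) (fib (suc n)))
... | inj₂ refl = m<m+n (fib (2 + n)) (fib-pos n)

fib-injective-from-2 : ∀ {m n} → fib (2 + m) ≡ fib (2 + n) → m ≡ n
fib-injective-from-2 {m} {n} e with <-cmp m n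
... | tri< m<n _ _ = ⊥-elim (<-irrefl e (fib-strict m<n))
... | tri≈ _ m≡n _ = m≡n
... | tri> _ _ n<m = ⊥-elim (<-irrefl (sym e) (fib-strict n<m))

-- A Fibonacci number ≥ 2 determines its index (F 1 = F 2 is the only clash).
fib-injective : ∀ {m n} → 2 ≤ fib m → fib m ≡ fib n → m ≡ n
fib-injective {suc zero} (s≤s ()) _
fib-injective {suc (suc m)} {zero} 2≤F e with subst (2 ≤_) e 2≤F
... | ()
fib-injective {suc (suc m)} {suc zero} 2≤F e with subst (2 ≤_) e 2≤F
... | s≤s ()
fib-injective {suc (suc m)} {suc (suc n)} _ e = cong (λ j → 2 + j) (fib-injective-from-2 e)

exceeds : ∀ {a c Q} → 1 ≤ Q → a + Q ≡ c → c ≤ a → ⊥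
exceeds {a} 1≤Q a+Q≡c c≤a = <⇒≱ (subst (a <_) a+Q≡c (m<m+n a 1≤Q)) c≤a

-- For t = k + 3, unless b and d both equal k + 2 the right-hand side is at
-- most F (k+1) + F (k+2) = F t; for t ≤ 2 it is at most 2 < F t + Q.
fib-sum-rigidity : ∀ {t b d Q} → b < t → d < t → 2 ≤ Q → fib t + Q ≡ fib b + fib d →
                   ∃[ k ] (t ≡ 3 + k × fib b ≡ fib (2 + k) × fib d ≡ fib (2 + k) × Q ≡ fib k)
fib-sum-rigidity {suc zero} (s≤s z≤n) (s≤s z≤n) _ ()
fib-sum-rigidity {suc (suc zero)} {b} {d} {Q} b<2 d<2 2≤Q e =
  ⊥-elim (<⇒≱ (m<n+m Q z<s) (begin
    1 + Q            ≡⟨ e ⟩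
    fib b + fib d    ≤⟨ +-mono-≤ (fib-mono (≤-pred b<2)) (fib-mono (≤-pred d<2)) ⟩
    2                ≤⟨ 2≤Q ⟩
    Q                ∎))
  where open ≤-Reasoning
fib-sum-rigidity {suc (suc (suc k))} {b} {d} {Q} b<t d<t 2≤Q e
  with b ≟ 2 + k | d ≟ 2 + k
... | yes refl | yes refl = k , refl , refl , refl , Q≡Fk
  where
    F₂ = fib (2 + k)
    F₁ = fib (1 + k)
    Q≡Fk : Q ≡ fib k
    Q≡Fk = +-cancelˡ-≡ F₁ Q (fib k)
             (+-cancelˡ-≡ F₂ (F₁ + Q) (F₁ + fib k) (trans (sym (+-assoc F₂ F₁ Q)) e))
... | no b≢k | _ = ⊥-elim $ exceeds (≤-trans (s≤s z≤n) 2≤Q) e (begin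
    fib b + fib d              ≤⟨ +-mono-≤ (fib-mono (≤-pred (≤∧≢⇒< (≤-pred b<t) b≢k)))
                                           (fib-mono (≤-pred d<t)) ⟩
    fib (1 + k) + fib (2 + k)  ≡⟨ +-comm (fib (1 + k)) (fib (2 + k)) ⟩
    fib (3 + k)                ∎)
  where open ≤-Reasoning
... | yes _ | no d≢k = ⊥-elim $ exceeds (≤-trans (s≤s z≤n) 2≤Q) e
    (+-mono-≤ (fib-mono (≤-pred b<t)) (fib-mono (≤-pred (≤∧≢⇒< (≤-pred d<t) d≢k))))

data CyclicPeak (a b c d : ℕ) : Set where
  peak-a : b ≤ a → d ≤ a → CyclicPeak a b c d
  peak-b : c ≤ b → a ≤ b → CyclicPeak a b c d
  peak-c : d ≤ c → b ≤ c → CyclicPeak a b c d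
  peak-d : a ≤ d → c ≤ d → CyclicPeak a b c d

cyclic-peak : ∀ a b c d → CyclicPeak a b c d
cyclic-peak a b c d with ≤-total c a | ≤-total d b
cyclic-peak a b c d | inj₁ c≤a | inj₁ d≤b with ≤-total b a
... | inj₁ b≤a = peak-a b≤a (≤-trans d≤b b≤a)
... | inj₂ a≤b = peak-b (≤-trans c≤a a≤b) a≤b
cyclic-peak a b c d | inj₁ c≤a | inj₂ b≤d with ≤-total d a
... | inj₁ d≤a = peak-a (≤-trans b≤d d≤a) d≤a
... | inj₂ a≤d = peak-d a≤d (≤-trans c≤a a≤d)
cyclic-peak a b c d | inj₂ a≤c | inj₁ d≤b with ≤-total b c
... | inj₁ b≤c = peak-c (≤-trans d≤b b≤c) b≤c
... | inj₂ c≤b = peak-b c≤b (≤-trans a≤c c≤b)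
cyclic-peak a b c d | inj₂ a≤c | inj₂ b≤d with ≤-total d c
... | inj₁ d≤c = peak-c d≤c (≤-trans b≤d d≤c)
... | inj₂ c≤d = peak-d (≤-trans a≤c c≤d) c≤d

opposite-edges : ∀ P Q R S → (P + Q) + (R + S) ≡ (Q + R) + (S + P)
opposite-edges = solve-∀

-- Distinctness of opposite vertices makes the domination strict.
dominant-edge : ∀ {P Q R S t b d} → P ≢ R → Q ≢ S → 2 ≤ R + S →
                P + Q ≡ fib t → Q + R ≡ fib b → S + P ≡ fib d → b ≤ t → d ≤ t →
                ∃[ k ] (P + Q ≡ fib (3 + k) × Q + R ≡ fib (2 + k) ×
                        R + S ≡ fib k × S + P ≡ fib (2 + k))
dominant-edge {P} {Q} {R} {S} {t} {b} {d} P≢R Q≢S 2≤RS PQ QR SP b≤t d≤t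
  with fib-sum-rigidity (≤∧≢⇒< b≤t b≢t) (≤∧≢⇒< d≤t d≢t) 2≤RS sums
  where
    b≢t : b ≢ t
    b≢t refl = P≢R (+-cancelˡ-≡ Q P R (trans (+-comm Q P) (trans PQ (sym QR))))
    d≢t : d ≢ t
    d≢t refl = Q≢S (+-cancelˡ-≡ P Q S (trans PQ (trans (sym SP) (+-comm S P))))
    sums : fib t + (R + S) ≡ fib b + fib d
    sums = begin
      fib t + (R + S)    ≡⟨ cong (_+ (R + S)) PQ ⟨
      (P + Q) + (R + S)  ≡⟨ opposite-edges P Q R S ⟩
      (Q + R) + (S + P)  ≡⟨ cong₂ _+_ QR SP ⟩
      fib b + fib d      ∎
      where open ≡-Reasoning
... | k , refl , Fb , Fd , RS = k , PQ , trans QR Fb , RS , trans SP Fd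

record FibSquare (U V X Y : ℕ) : Set where
  field
    u-pos : 1 ≤ U
    v-pos : 1 ≤ V
    x-pos : 1 ≤ X
    y-pos : 1 ≤ Y
    x≢v : X ≢ V
    y≢u : Y ≢ U
    uv-fib : IsFib (U + V)
    ux-fib : IsFib (U + X)
    xy-fib : IsFib (X + Y)
    yv-fib : IsFib (Y + V)

-- Seen from the edge uv, a square is flat when its dominant edge is xy ...
Flat : ℕ → ℕ → ℕ → Set
Flat U V X = ∃[ k ] (U + V ≡ fib k × U + X ≡ fib (2 + k))

-- ... and steep when the dominant edge touches u or v.  Only the facts
-- about U, V and U + X are recorded; Y enters through the bounds on U, V.
data Steep (U V X : ℕ) : Set where
  uv-peak : ∀ k → U + V ≡ fib (3 + k) → U + X ≡ fib (2 + k) →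
            U < fib (2 + k) → V < fib (2 + k) → Steep U V X
  ux-peak : ∀ k → U + V ≡ fib (2 + k) → U + X ≡ fib (3 + k) → V < fib k → Steep U V X
  yv-peak : ∀ k → U + V ≡ fib (2 + k) → U + X ≡ fib k → U < fib k → Steep U V X

summand-<ˡ : ∀ {A B n} → 1 ≤ B → A + B ≡ n → A < n
summand-<ˡ {A} 1≤B A+B≡n = subst (A <_) A+B≡n (m<m+n A 1≤B)

summand-<ʳ : ∀ {A B n} → 1 ≤ A → A + B ≡ n → B < n
summand-<ʳ {A} {B} 1≤A A+B≡n = summand-<ˡ 1≤A (trans (+-comm B A) A+B≡n)

-- Every square is flat or steep: apply dominant-edge to the edge whose
-- Fibonacci index is a cyclic peak, reading the cycle from that edge.
classify : ∀ {U V X Y} → FibSquare U V X Y → Flat U V X ⊎ Steep U V X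
classify {U} {V} {X} {Y} sq = from-peak (cyclic-peak a b c d)
  where
    open FibSquare sq
    a = proj₁ uv-fib
    b = proj₁ ux-fib
    c = proj₁ xy-fib
    d = proj₁ yv-fib
    VU : V + U ≡ fib a
    VU = trans (+-comm V U) (sym (proj₂ uv-fib))
    UX : U + X ≡ fib b
    UX = sym (proj₂ ux-fib)
    XY : X + Y ≡ fib c
    XY = sym (proj₂ xy-fib)
    YV : Y + V ≡ fib d
    YV = sym (proj₂ yv-fib)
    uv≡ : ∀ {n} → V + U ≡ n → U + V ≡ n
    uv≡ = trans (+-comm U V)
    from-peak : CyclicPeak a b c d → Flat U V X ⊎ Steep U V X
    from-peak (peak-a b≤a d≤a)
      with dominant-edge (x≢v ∘ sym) (y≢u ∘ sym) (+-mono-≤ x-pos y-pos) VU UX YV b≤a d≤a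
    ... | k , vu , ux , _ , yv =
      inj₂ (uv-peak k (uv≡ vu) ux (summand-<ˡ x-pos ux) (summand-<ʳ y-pos yv))
    from-peak (peak-b c≤b a≤b)
      with dominant-edge (y≢u ∘ sym) x≢v (+-mono-≤ y-pos v-pos) UX XY VU c≤b a≤b
    ... | k , ux , _ , yv , vu = inj₂ (ux-peak k (uv≡ vu) ux (summand-<ʳ y-pos yv))
    from-peak (peak-c d≤c b≤c)
      with dominant-edge x≢v y≢u (+-mono-≤ v-pos u-pos) XY YV UX d≤c b≤c
    ... | k , _ , _ , vu , ux = inj₁ (k , uv≡ vu , ux)
    from-peak (peak-d a≤d c≤d)
      with dominant-edge y≢u (x≢v ∘ sym) (+-mono-≤ u-pos x-pos) YV VU XY a≤d c≤d
    ... | k , _ , vu , ux , _ = inj₂ (yv-peak k (uv≡ vu) ux (summand-<ˡ x-pos ux))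

same-partner : ∀ {U X X' n} → U + X ≡ n → U + X' ≡ n → X ≡ X'
same-partner {U} UX UX' = +-cancelˡ-≡ U _ _ (trans UX (sym UX'))

flat-unique : ∀ {U V X X'} → 2 ≤ U + V → Flat U V X → Flat U V X' → X ≡ X'
flat-unique 2≤UV (k , UV , UX) (k' , UV' , UX')
  with fib-injective {k} {k'} (subst (2 ≤_) UV 2≤UV) (trans (sym UV) UV')
... | refl = same-partner UX UX'

sum-below-fib : ∀ {A B} i → A < fib (suc i) → B < fib i → A + B ≢ fib (2 + i)
sum-below-fib i A< B< A+B≡ = <-irrefl A+B≡ (+-mono-< A< B<)

-- Different steep configurations are incompatible: their bounds on U and
-- V would place U + V below its own Fibonacci value.
uv-ux-clash : ∀ {U V} k k' → U + V ≡ fib (3 + k) → U < fib (2 + k) →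
              U + V ≡ fib (2 + k') → V < fib k' → ⊥
uv-ux-clash k k' UV U< UV' V< with fib-injective-from-2 {suc k} {k'} (trans (sym UV) UV')
... | refl = sum-below-fib k' U< V< UV

uv-yv-clash : ∀ {U V} k k' → U + V ≡ fib (3 + k) → V < fib (2 + k) →
              U + V ≡ fib (2 + k') → U < fib k' → ⊥
uv-yv-clash {U} {V} k k' UV V< UV' U< with fib-injective-from-2 {suc k} {k'} (trans (sym UV) UV')
... | refl = sum-below-fib k' V< U< (trans (+-comm V U) UV)

ux-yv-clash : ∀ {U V} k k' → U + V ≡ fib (2 + k) → V < fib k →
              U + V ≡ fib (2 + k') → U < fib k' → ⊥
ux-yv-clash k k' UV V< UV' U< with fib-injective-from-2 {k} {k'} (trans (sym UV) UV')
... | refl = sum-below-fib k (<-≤-trans U< (fib-≤-suc k)) V< UV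

steep-unique : ∀ {U V X X'} → Steep U V X → Steep U V X' → X ≡ X'
steep-unique (uv-peak k UV UX _ _) (uv-peak k' UV' UX' _ _)
  with fib-injective-from-2 {suc k} {suc k'} (trans (sym UV) UV')
... | refl = same-partner UX UX'
steep-unique (ux-peak k UV UX _) (ux-peak k' UV' UX' _)
  with fib-injective-from-2 {k} {k'} (trans (sym UV) UV')
... | refl = same-partner UX UX'
steep-unique (yv-peak k UV UX _) (yv-peak k' UV' UX' _)
  with fib-injective-from-2 {k} {k'} (trans (sym UV) UV')
... | refl = same-partner UX UX'
steep-unique (uv-peak k UV _ U< _) (ux-peak k' UV' _ V<) = ⊥-elim (uv-ux-clash k k' UV U< UV' V<)
steep-unique (ux-peak k UV _ V<) (uv-peak k' UV' _ U< _) = ⊥-elim (uv-ux-clash k' k UV' U< UV V<)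
steep-unique (uv-peak k UV _ _ V<) (yv-peak k' UV' _ U<) = ⊥-elim (uv-yv-clash k k' UV V< UV' U<)
steep-unique (yv-peak k UV _ U<) (uv-peak k' UV' _ _ V<) = ⊥-elim (uv-yv-clash k' k UV' V< UV U<)
steep-unique (ux-peak k UV _ V<) (yv-peak k' UV' _ U<) = ⊥-elim (ux-yv-clash k k' UV V< UV' U<)
steep-unique (yv-peak k UV _ U<) (ux-peak k' UV' _ V<) = ⊥-elim (ux-yv-clash k' k UV' V< UV U<)

two-class-pigeonhole : {A : Set} {P Q : A → Set} →
                       (∀ {a b} → P a → P b → a ≡ b) → (∀ {a b} → Q a → Q b → a ≡ b) →
                       ∀ {a b c} → P a ⊎ Q a → P b ⊎ Q b → P c ⊎ Q c → a ≡ b ⊎ (a ≡ c ⊎ b ≡ c)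
two-class-pigeonhole P! Q! (inj₁ pa) (inj₁ pb) _ = inj₁ (P! pa pb)
two-class-pigeonhole P! Q! (inj₂ qa) (inj₂ qb) _ = inj₁ (Q! qa qb)
two-class-pigeonhole P! Q! (inj₁ pa) (inj₂ qb) (inj₁ pc) = inj₂ (inj₁ (P! pa pc))
two-class-pigeonhole P! Q! (inj₁ pa) (inj₂ qb) (inj₂ qc) = inj₂ (inj₂ (Q! qb qc))
two-class-pigeonhole P! Q! (inj₂ qa) (inj₁ pb) (inj₁ pc) = inj₂ (inj₂ (P! pb pc))
two-class-pigeonhole P! Q! (inj₂ qa) (inj₁ pb) (inj₂ qc) = inj₂ (inj₁ (Q! qa qc))

lemma9 : ∀ (n : ℕ) → n ≥ 1 → ¬ ContainsH n
lemma9 n _ (f , f-inj , f-range , f-edge) =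
  [ distinct (λ ()) , [ distinct (λ ()) , distinct (λ ()) ] ] labels-collide
  where
    label-pos : ∀ a → 1 ≤ f a
    label-pos a = proj₁ (f-range a)
    fib-edge : ∀ {a b} → HEdge a b → IsFib (f a + f b)
    fib-edge e = proj₂ (proj₂ (proj₂ (f-edge e)))
    distinct : ∀ {a b} → a ≢ b → f a ≢ f b
    distinct a≢b = a≢b ∘ f-inj
    square-through : ∀ {x y} → HEdge u x → HEdge x y → HEdge y v → x ≢ v → y ≢ u →
                     Flat (f u) (f v) (f x) ⊎ Steep (f u) (f v) (f x)
    square-through {x} {y} ux xy yv x≢v y≢u = classify record
      { u-pos = label-pos u ; v-pos = label-pos v ; x-pos = label-pos x ; y-pos = label-pos y
      ; x≢v = distinct x≢v ; y≢u = distinct y≢u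
      ; uv-fib = fib-edge e-uv ; ux-fib = fib-edge ux ; xy-fib = fib-edge xy ; yv-fib = fib-edge yv }
    labels-collide : f x₁ ≡ f x₂ ⊎ (f x₁ ≡ f x₃ ⊎ f x₂ ≡ f x₃)
    labels-collide =
      two-class-pigeonhole {P = Flat (f u) (f v)} {Q = Steep (f u) (f v)}
        (flat-unique (+-mono-≤ (label-pos u) (label-pos v))) steep-unique
        (square-through e-ux₁ e-x₁y₁ e-y₁v (λ ()) (λ ()))
        (square-through e-ux₂ e-x₂y₂ e-y₂v (λ ()) (λ ()))
        (square-through e-ux₃ e-x₃y₃ e-y₃v (λ ()) (λ ()))
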